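{- Let $v>k>i\ge 0$ be integers with $v\ge 2k$ and $(v,k,i)\neq(2k,k,0)$, and let $X=J(v,k,i)$. If $(v,k,i)\neq(2k+1,k,0)$, then the girth of $X$ satisfies $g(X)\le 4$.
   Context: For integers $v>k>i\ge 0$, the generalized Johnson graph $J(v,k,i)$ is the simple undirected graph whose vertices are the $k$-element subsets of a fixed $v$-element set, two vertices $A,B$ being adjacent iff $|A\cap B|=i$. The girth is the length of a shortest cycle. -}

module Defs where

open import Level using (Level; _⊔_)
open import Data.Nat using (ℕ; zero; suc; _≤_)
open import Data.Fin using (Fin; zero; suc; inject₁; fromℕ)
open import Data.Fin.Subset using (Subset; _∩_; ∣_∣)
open import Data.Product using (Σ; ∃; _×_; _,_)
open import Relation.Binary.PropositionalEquality using (_≡_)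

record Cycle {a ℓ : Level} (V : Set a) (_~_ : V → V → Set ℓ) (m : ℕ) : Set (a ⊔ ℓ) where
  field
    long     : 3 ≤ suc m
    vertex   : Fin (suc m) → V
    distinct : ∀ p q → vertex p ≡ vertex q → p ≡ q
    step     : ∀ (j : Fin m) → vertex (inject₁ j) ~ vertex (suc j)
    close    : vertex (fromℕ m) ~ vertex zero

GirthAtMost : {a ℓ : Level} (V : Set a) (_~_ : V → V → Set ℓ) → ℕ → Set (a ⊔ ℓ)
GirthAtMost V _~_ g = ∃ λ m → suc m ≤ g × Cycle V _~_ m

JVertex : ℕ → ℕ → Set
JVertex v k = Σ (Subset v) (λ A → ∣ A ∣ ≡ k)

JAdj : (v k i : ℕ) → JVertex v k → JVertex v k → Set
JAdj v k i (A , _) (B , _) = ∣ A ∩ B ∣ ≡ i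

module Submission where

-- For i = 0 the hypotheses force v ≥ 2k+2, and two disjoint
-- (k−1)-sets P, Q with four further points give the 4-cycle P+a, Q+b, P+c, Q+d. For k = i+1 three
-- k-sets through a common i-set form a triangle. For 1 ≤ i ≤ k−2 a 4-cycle is built around a common
-- (i−1)-set, consecutive vertices sharing it plus one point. In every case at most 2k+1−i points are
-- used (2k+2 if i = 0), which is at most v, and the remaining points are left out of all vertices.

open import Defs
open import Data.Bool using (_∧_)
open import Data.Fin using (zero; suc; inject₁; fromℕ)
open import Data.Fin.Subset using (Subset; _∩_; ∣_∣; inside; outside)
open import Data.Fin.Subset.Properties using (∩-idem; ∣⊤∣≡n; ∣⊥∣≡0)
open import Data.Nat using (ℕ; zero; suc; _<_; _≤_; _+_; _*_; s≤s; z≤n)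
open import Data.Nat.Properties
  using (≤-refl; m≤m+n; ≤∧≢⇒<; m∸n+n≡m; <⇒≢; m≤n⇒∃[o]m+o≡n; +-identityʳ; +-comm; n<1+n; m≤n⇒m≤1+n; *-suc; m+n≤o⇒m≤o; _≟_)
open import Data.Nat.Tactic.RingSolver using (solve-∀)
open import Data.Product using (_×_; _,_; proj₁)
open import Data.Vec using (Vec; []; _∷_; _++_; replicate; lookup; sum)
open import Data.Vec.Properties using (zipWith-++; zipWith-replicate)
open import Data.Vec.Relation.Unary.All using ([]; _∷_)
open import Data.Vec.Relation.Unary.AllPairs using ([]; _∷_)
open import Data.Vec.Relation.Unary.Linked using (Linked; [-]; _∷_)
open import Data.Vec.Relation.Unary.Unique.Propositional using (Unique)
open import Data.Vec.Relation.Unary.Unique.Propositional.Properties using (lookup-injective)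
open import Relation.Nullary using (¬_; yes; no)
open import Relation.Binary.PropositionalEquality

module _ {a ℓ} {V : Set a} {_~_ : V → V → Set ℓ} where

  lookup-linked : ∀ {m} {xs : Vec V (suc m)} → Linked _~_ xs →
                  ∀ j → lookup xs (inject₁ j) ~ lookup xs (suc j)
  lookup-linked {xs = _ ∷ _ ∷ _} (x~y ∷ _)   zero    = x~y
  lookup-linked                  (_   ∷ x~s) (suc j) = lookup-linked x~s j

  cycle : ∀ {m} (xs : Vec V (suc m)) → 3 ≤ suc m → Unique xs → Linked _~_ xs →
          lookup xs (fromℕ m) ~ lookup xs zero → Cycle V _~_ m
  cycle xs long unique linked close = record
    { long     = long
    ; vertex   = lookup xs
    ; distinct = lookup-injective unique
    ; step     = lookup-linked linked
    ; close    = close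
    }

  module _ (~⇒≢ : ∀ {x y} → x ~ y → x ≢ y) where

    triangle⇒girth≤4 : ∀ {x y z} → x ~ y → y ~ z → z ~ x → GirthAtMost V _~_ 4
    triangle⇒girth≤4 {x} {y} {z} x~y y~z z~x =
      2 , s≤s (s≤s (s≤s z≤n)) , cycle (x ∷ y ∷ z ∷ []) ≤-refl unique (x~y ∷ y~z ∷ [-]) z~x
      where
      unique : Unique (x ∷ y ∷ z ∷ [])
      unique = (~⇒≢ x~y ∷ ≢-sym (~⇒≢ z~x) ∷ []) ∷ (~⇒≢ y~z ∷ []) ∷ [] ∷ []

    square⇒girth≤4 : ∀ {x y z w} → x ~ y → y ~ z → z ~ w → w ~ x → x ≢ z → y ≢ w →
                     GirthAtMost V _~_ 4
    square⇒girth≤4 {x} {y} {z} {w} x~y y~z z~w w~x x≢z y≢w =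
      3 , ≤-refl , cycle (x ∷ y ∷ z ∷ w ∷ []) (s≤s (s≤s (s≤s z≤n))) unique (x~y ∷ y~z ∷ z~w ∷ [-]) w~x
      where
      unique : Unique (x ∷ y ∷ z ∷ w ∷ [])
      unique = (~⇒≢ x~y ∷ x≢z ∷ ≢-sym (~⇒≢ w~x) ∷ [])
             ∷ (~⇒≢ y~z ∷ y≢w ∷ [])
             ∷ (~⇒≢ z~w ∷ [])
             ∷ [] ∷ []

∣p++q∣≡∣p∣+∣q∣ : ∀ {m n} (p : Subset m) (q : Subset n) → ∣ p ++ q ∣ ≡ ∣ p ∣ + ∣ q ∣
∣p++q∣≡∣p∣+∣q∣ []            q = refl
∣p++q∣≡∣p∣+∣q∣ (inside  ∷ p) q = cong suc (∣p++q∣≡∣p∣+∣q∣ p q)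
∣p++q∣≡∣p∣+∣q∣ (outside ∷ p) q = ∣p++q∣≡∣p∣+∣q∣ p q

-- Fin (sum ns) is cut into consecutive intervals of sizes ns; blocks ns bs is the union of the chosen ones.
blocks : ∀ {r} (ns : Vec ℕ r) → Subset r → Subset (sum ns)
blocks []       []       = []
blocks (n ∷ ns) (b ∷ bs) = replicate n b ++ blocks ns bs

weight : ∀ {r} → Vec ℕ r → Subset r → ℕ
weight []       []             = 0
weight (n ∷ ns) (inside  ∷ bs) = n + weight ns bs
weight (_ ∷ ns) (outside ∷ bs) = weight ns bs

∣blocks∣ : ∀ {r} (ns : Vec ℕ r) bs → ∣ blocks ns bs ∣ ≡ weight ns bs
∣blocks∣ []       []             = refl
∣blocks∣ (n ∷ ns) (inside  ∷ bs) =
  trans (∣p++q∣≡∣p∣+∣q∣ (replicate n inside) _) (cong₂ _+_ (∣⊤∣≡n n) (∣blocks∣ ns bs))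
∣blocks∣ (n ∷ ns) (outside ∷ bs) =
  trans (∣p++q∣≡∣p∣+∣q∣ (replicate n outside) _) (cong₂ _+_ (∣⊥∣≡0 n) (∣blocks∣ ns bs))

blocks-∩ : ∀ {r} (ns : Vec ℕ r) ps qs → blocks ns ps ∩ blocks ns qs ≡ blocks ns (ps ∩ qs)
blocks-∩ []       []       []       = refl
blocks-∩ (n ∷ ns) (p ∷ ps) (q ∷ qs) = begin
  (replicate n p ++ blocks ns ps) ∩ (replicate n q ++ blocks ns qs)
    ≡⟨ zipWith-++ _∧_ (replicate n p) _ (replicate n q) _ ⟩
  replicate n p ∩ replicate n q ++ blocks ns ps ∩ blocks ns qs
    ≡⟨ cong₂ _++_ (zipWith-replicate _∧_ p q) (blocks-∩ ns ps qs) ⟩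
  replicate n (p ∧ q) ++ blocks ns (ps ∩ qs)
    ∎
  where open ≡-Reasoning

∣blocks∩blocks∣ : ∀ {r} (ns : Vec ℕ r) ps qs → ∣ blocks ns ps ∩ blocks ns qs ∣ ≡ weight ns (ps ∩ qs)
∣blocks∩blocks∣ ns ps qs = trans (cong ∣_∣ (blocks-∩ ns ps qs)) (∣blocks∣ ns (ps ∩ qs))

JohnsonGirth≤4 : ℕ → ℕ → ℕ → Set
JohnsonGirth≤4 v k i = GirthAtMost (JVertex v k) (JAdj v k i) 4

JohnsonGirth≤4-pad : ∀ {n v k i} → (∀ e → JohnsonGirth≤4 (e + n) k i) → n ≤ v → JohnsonGirth≤4 v k i
JohnsonGirth≤4-pad {k = k} {i} padded n≤v =
  subst (λ v → JohnsonGirth≤4 v k i) (m∸n+n≡m n≤v) (padded _)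

module _ {v k : ℕ} where

  overlap≢size⇒≢ : {A B : JVertex v k} → ∣ proj₁ A ∩ proj₁ B ∣ ≢ k → A ≢ B
  overlap≢size⇒≢ {A , ∣A∣≡k} A∩A≢k refl = A∩A≢k (trans (cong ∣_∣ (∩-idem A)) ∣A∣≡k)

  JAdj⇒≢ : ∀ {i} {A B : JVertex v k} → i ≢ k → JAdj v k i A B → A ≢ B
  JAdj⇒≢ i≢k A∩B≡i = overlap≢size⇒≢ (λ A∩B≡k → i≢k (trans (sym A∩B≡i) A∩B≡k))

module BlockVertices {r} (ns : Vec ℕ r) where

  vertex : ∀ {k} (ps : Subset r) → weight ns ps ≡ k → JVertex (sum ns) k
  vertex ps ∣ps∣≡k = blocks ns ps , trans (∣blocks∣ ns ps) ∣ps∣≡k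

  overlap≡ : ∀ {i} ps qs → weight ns (ps ∩ qs) ≡ i → ∣ blocks ns ps ∩ blocks ns qs ∣ ≡ i
  overlap≡ ps qs = trans (∣blocks∩blocks∣ ns ps qs)

  overlap≢ : ∀ {k} ps qs → weight ns ps ≡ k → weight ns (ps ∩ qs) < weight ns ps →
             ∣ blocks ns ps ∩ blocks ns qs ∣ ≢ k
  overlap≢ ps qs ∣ps∣≡k lt overlap≡k =
    <⇒≢ lt (trans (sym (∣blocks∩blocks∣ ns ps qs)) (trans overlap≡k (sym ∣ps∣≡k)))

-- Blocks: padding, a, b, c, d, P, Q.
disjoint-square : ∀ k e → JohnsonGirth≤4 (e + (4 + 2 * k)) (suc k) 0
disjoint-square k e =
  square⇒girth≤4 (JAdj⇒≢ λ ()) {vertex A size} {vertex B size} {vertex C size} {vertex D size}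
    (overlap≡ A B refl) (overlap≡ B C refl) (overlap≡ C D refl) (overlap≡ D A refl)
    (overlap≢size⇒≢ (overlap≢ A C size ≤-refl)) (overlap≢size⇒≢ (overlap≢ B D size ≤-refl))
  where
  open BlockVertices (e ∷ 1 ∷ 1 ∷ 1 ∷ 1 ∷ k ∷ k ∷ [])
  A B C D : Subset 7
  A = outside ∷ inside  ∷ outside ∷ outside ∷ outside ∷ inside  ∷ outside ∷ []
  B = outside ∷ outside ∷ inside  ∷ outside ∷ outside ∷ outside ∷ inside  ∷ []
  C = outside ∷ outside ∷ outside ∷ inside  ∷ outside ∷ inside  ∷ outside ∷ []
  D = outside ∷ outside ∷ outside ∷ outside ∷ inside  ∷ outside ∷ inside  ∷ []
  size : suc (k + 0) ≡ suc k
  size = cong suc (+-identityʳ k)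

-- Blocks: padding, I, a, b, c.
triangle : ∀ i e → JohnsonGirth≤4 (e + (i + 3)) (suc i) i
triangle i e =
  triangle⇒girth≤4 (JAdj⇒≢ (<⇒≢ (n<1+n i))) {vertex A size} {vertex B size} {vertex C size}
    (overlap≡ A B shared) (overlap≡ B C shared) (overlap≡ C A shared)
  where
  open BlockVertices (e ∷ i ∷ 1 ∷ 1 ∷ 1 ∷ [])
  A B C : Subset 5
  A = outside ∷ inside ∷ inside  ∷ outside ∷ outside ∷ []
  B = outside ∷ inside ∷ outside ∷ inside  ∷ outside ∷ []
  C = outside ∷ inside ∷ outside ∷ outside ∷ inside  ∷ []
  size : i + 1 ≡ suc i
  size = +-comm i 1
  shared : i + 0 ≡ i
  shared = +-identityʳ i

-- Blocks: padding, p, p′, a, a′, b, b′, I, P, R; the cycle is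
-- I+P+p+p′+a, I+R+a+a′+b, I+P+p+p′+a′, I+R+a+a′+b′.
overlapping-square : ∀ j r e → JohnsonGirth≤4 (e + (6 + (j + 2 * r))) (3 + (j + r)) (suc j)
overlapping-square j r e =
  square⇒girth≤4 (JAdj⇒≢ (<⇒≢ i<k)) {vertex A size} {vertex B size} {vertex C size} {vertex D size}
    (overlap≡ A B shared) (overlap≡ B C shared) (overlap≡ C D shared) (overlap≡ D A shared)
    (overlap≢size⇒≢ (overlap≢ A C size ≤-refl)) (overlap≢size⇒≢ (overlap≢ B D size ≤-refl))
  where
  open BlockVertices (e ∷ 1 ∷ 1 ∷ 1 ∷ 1 ∷ 1 ∷ 1 ∷ j ∷ r ∷ r ∷ [])
  A B C D : Subset 10
  A = outside ∷ inside  ∷ inside  ∷ inside  ∷ outside ∷ outside ∷ outside ∷ inside ∷ inside  ∷ outside ∷ []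
  B = outside ∷ outside ∷ outside ∷ inside  ∷ inside  ∷ inside  ∷ outside ∷ inside ∷ outside ∷ inside  ∷ []
  C = outside ∷ inside  ∷ inside  ∷ outside ∷ inside  ∷ outside ∷ outside ∷ inside ∷ inside  ∷ outside ∷ []
  D = outside ∷ outside ∷ outside ∷ inside  ∷ inside  ∷ outside ∷ inside  ∷ inside ∷ outside ∷ inside  ∷ []
  size : 3 + (j + (r + 0)) ≡ 3 + (j + r)
  size = cong (λ x → 3 + (j + x)) (+-identityʳ r)
  shared : suc (j + 0) ≡ suc j
  shared = cong suc (+-identityʳ j)
  i<k : suc j < 3 + (j + r)
  i<k = s≤s (s≤s (m≤n⇒m≤1+n (m≤m+n j r)))

lemma2p3 : (v k i : ℕ) → i < k → k < v → 2 * k ≤ v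
           → ¬ (v ≡ 2 * k × i ≡ 0) → ¬ (v ≡ 2 * k + 1 × i ≡ 0)
           → GirthAtMost (JVertex v k) (JAdj v k i) 4
lemma2p3 v zero zero () _ _ _ _
lemma2p3 v (suc k) zero _ _ 2k≤v v≢2k v≢2k+1 =
  JohnsonGirth≤4-pad (disjoint-square k) (subst (_≤ v) (cong (2 +_) (*-suc 2 k)) 2+2k≤v)
  where
  2+2k≤v : 2 + 2 * suc k ≤ v
  2+2k≤v = ≤∧≢⇒< (≤∧≢⇒< 2k≤v λ 2k≡v → v≢2k (sym 2k≡v , refl))
                 λ 2k+1≡v → v≢2k+1 (trans (sym 2k+1≡v) (+-comm 1 (2 * suc k)) , refl)
lemma2p3 v k (suc j) i<k _ 2k≤v _ _ with suc (suc j) ≟ k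
... | yes refl =
  JohnsonGirth≤4-pad (triangle (suc j)) (m+n≤o⇒m≤o _ (subst (_≤ v) (triangle-size j) 2k≤v))
  where
  triangle-size : ∀ j → 2 * (2 + j) ≡ (1 + j + 3) + j
  triangle-size = solve-∀
... | no 1+i≢k with m≤n⇒∃[o]m+o≡n (≤∧≢⇒< i<k 1+i≢k)
...   | r , refl =
  JohnsonGirth≤4-pad (overlapping-square j r) (m+n≤o⇒m≤o _ (subst (_≤ v) (overlapping-size j r) 2k≤v))
  where
  overlapping-size : ∀ j r → 2 * (3 + (j + r)) ≡ (6 + (j + 2 * r)) + j
  overlapping-size = solve-∀
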